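{- Let $\mathcal{I}$ be an ideal on $\mathbb{N}$ with the Baire property. Then there is an $\mathcal{I}$-TAD family of cardinality $\mathfrak{c}$.
   Context: For $A\subseteq\mathbb{N}$ and $k\in\mathbb{Z}$, $A+k$ denotes $\{a+k:a\in A\}\cap\mathbb{N}$. An ideal on $\mathbb{N}$ is a family $\mathcal{I}\subseteq\mathcal{P}(\mathbb{N})$ closed under finite unions and subsets, containing all finite subsets of $\mathbb{N}$, with $\mathbb{N}\notin\mathcal{I}$. $\mathcal{I}^+=\{A\subseteq\mathbb{N}:A\notin\mathcal{I}\}$. A family $\mathcal{A}\subseteq\mathcal{P}(\mathbb{N})$ is an $\mathcal{I}$-TAD family if $\mathcal{A}\subseteq\mathcal{I}^+$ and $A\cap(B+k)\in\mathcal{I}$ for all distinct $A,B\in\mathcal{A}$ and all $k\in\mathbb{Z}$. Subsets of $\mathbb{N}$ are identified with their characteristic functions, so $\mathcal{P}(\mathbb{N})$ carries the topology of the Cantor space $\{0,1\}^{\mathbb{N}}$; an ideal has the Baire property if it has the Baire property as a subset of this space. $\mathfrak{c}$ is the cardinality of the continuum. -}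

module Defs where

open import Data.Nat using (ℕ; zero; suc; _+_; _∸_; _≤_; _≤?_)
open import Data.Integer using (ℤ; +_; -[1+_])
open import Data.Bool using (Bool; true; false; _∧_; _∨_; T)
open import Data.List using (List; []; _∷_; _++_)
open import Data.Product using (Σ; _×_; ∃; ∃-syntax; _,_)
open import Data.Empty using (⊥)
open import Relation.Nullary using (¬_; yes; no)
open import Relation.Binary.PropositionalEquality using (_≡_)
open import Function using (_∘_)

-- Subsets of ℕ, identified with their characteristic functions (points of Cantor space).
Subset : Set
Subset = ℕ → Bool

_≈_ : Subset → Subset → Set
A ≈ B = ∀ n → A n ≡ B n

_⊆_ : Subset → Subset → Set
A ⊆ B = ∀ n → T (A n) → T (B n)

_∪_ : Subset → Subset → Subset
(A ∪ B) n = A n ∨ B n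

_∩_ : Subset → Subset → Subset
(A ∩ B) n = A n ∧ B n

whole : Subset
whole _ = true

Finite : Subset → Set
Finite A = ∃[ N ] (∀ m → N ≤ m → A m ≡ false)

-- A + k = { a + k : a ∈ A } ∩ ℕ
shift : Subset → ℤ → Subset
shift A (+ k) n with k ≤? n
... | yes _ = A (n ∸ k)
... | no  _ = false
shift A -[1+ k ] n = A (n + suc k)

record IsIdeal (I : Subset → Set) : Set where
  field
    union-closed  : ∀ A B → I A → I B → I (A ∪ B)
    subset-closed : ∀ A B → A ⊆ B → I B → I A
    finite-mem    : ∀ A → Finite A → I A
    whole-not-mem : ¬ I whole

Positive : (Subset → Set) → Subset → Set
Positive I A = ¬ I A

IsTAD : (Subset → Set) → (Subset → Set) → Set
IsTAD I 𝒜 =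
  (∀ A → 𝒜 A → Positive I A) ×
  (∀ A B → 𝒜 A → 𝒜 B → ¬ (A ≈ B) → ∀ (k : ℤ) → I (A ∩ shift B k))

-- The family 𝒜 has cardinality 𝔠: a bijection between Cantor space 2^ℕ and
-- 𝒜 (elements of 𝒜 taken up to extensional equality).
HasCardContinuum : (Subset → Set) → Set
HasCardContinuum 𝒜 =
  Σ ((ℕ → Bool) → Subset) λ F →
    (∀ x → 𝒜 (F x)) ×
    (∀ x y → F x ≈ F y → x ≈ y) ×
    (∀ A → 𝒜 A → ∃[ x ] (F x ≈ A))

Extends : List Bool → (ℕ → Bool) → Set
Extends []      x = Data.Unit.⊤ where import Data.Unit
Extends (b ∷ s) x = (x 0 ≡ b) × Extends s (x ∘ suc)

-- Open sets: unions of cylinders [s], s ∈ W.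
InOpen : (List Bool → Set) → (ℕ → Bool) → Set
InOpen W x = ∃[ s ] (W s × Extends s x)

NowhereDense : ((ℕ → Bool) → Set) → Set
NowhereDense N = ∀ s → ∃[ t ] (∀ x → Extends (s ++ t) x → ¬ N x)

Meager : ((ℕ → Bool) → Set) → Set₁
Meager M = Σ (ℕ → (ℕ → Bool) → Set) λ N →
  (∀ i → NowhereDense (N i)) × (∀ x → M x → ∃[ i ] N i x)

HasBaireProperty : ((ℕ → Bool) → Set) → Set₁
HasBaireProperty P = Σ (List Bool → Set) λ W →
  Meager (λ x → (P x × ¬ InOpen W x) ⊎ (InOpen W x × ¬ P x))
  where open import Data.Sum using (_⊎_)

-- An ideal with the Baire property is meager: otherwise it would be comeager in some cylinder
-- [s], and splicing a generic point and its complement onto s would put two sets into the ideal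
-- whose union with {0, …, |s| - 1} is ℕ.  A meager set ⋃ᵢ Nᵢ can be avoided blockwise: there are
-- intervals [start j, end j) with 2 · end j ≤ start (j + 1), and templates on them, such that
-- every point following template j on block j avoids N₀, …, Nⱼ.  Numbering the nodes of the
-- binary tree, attach to each branch x the set that follows the templates on the blocks numbered
-- by the prefixes of x and is empty elsewhere.  These 𝔠 sets avoid every Nᵢ, so they lie outside
-- the ideal; two distinct branches share only finitely many blocks, and since blocks double, a
-- point n of one set whose k-shift lies in a different block of the other satisfies n < 2k.
-- Hence every A ∩ (B + k) is finite.

module Submission where

open import Defs
open import Level using (0ℓ)
open import Axiom.ExcludedMiddle using (ExcludedMiddle)
open import Data.Nat using (ℕ; zero; suc; _+_; _∸_; _≤_; _<_; _≤?_; _<?_; z≤n; s≤s)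
open import Data.Nat.Properties
open import Data.Integer using (+_; -[1+_]; ∣_∣)
open import Data.Bool using (Bool; true; false; not; if_then_else_; T; _∧_)
open import Data.Bool.Properties using (not-involutive; ∧-idem) renaming (_≟_ to _≟ᵇ_)
open import Data.List using (List; []; _∷_; _++_; length; map)
open import Data.List.Properties using (++-identityʳ)
open import Data.List.Membership.Propositional using (_∈_)
open import Data.List.Membership.Propositional.Properties using (∈-map⁺; ∈-++⁺ˡ; ∈-++⁺ʳ)
open import Data.List.Relation.Unary.Any using (here; there)
open import Data.Product using (Σ; _×_; _,_; proj₁; proj₂; ∃-syntax)
open import Data.Sum using (_⊎_; inj₁; inj₂)
open import Data.Empty using (⊥; ⊥-elim)
open import Data.Unit using (⊤; tt)
open import Function using (_∘_; id)
open import Function.Bundles using (mk⇔)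
open import Relation.Nullary using (¬_; yes; no; does)
open import Relation.Nullary.Decidable using (dec-true; dec-false; decidable-stable; does-⇔)
open import Relation.Binary.PropositionalEquality using (_≡_; _≢_; refl; sym; trans; cong; cong₂; subst; module ≡-Reasoning)
open import Relation.Binary.Definitions using (tri<; tri≈; tri>)

pad : List Bool → Subset
pad []      m       = false
pad (b ∷ w) zero    = b
pad (b ∷ w) (suc m) = pad w m

prefix : ℕ → Subset → List Bool
prefix zero    x = []
prefix (suc n) x = x 0 ∷ prefix n (x ∘ suc)

words : ℕ → List (List Bool)
words zero    = [] ∷ []
words (suc n) = map (true ∷_) (words n) ++ map (false ∷_) (words n)

prefix∈words : ∀ n x → prefix n x ∈ words n
prefix∈words zero    x = here refl
prefix∈words (suc n) x with x 0
... | true  = ∈-++⁺ˡ (∈-map⁺ (true ∷_) (prefix∈words n (x ∘ suc)))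
... | false = ∈-++⁺ʳ (map (true ∷_) (words n)) (∈-map⁺ (false ∷_) (prefix∈words n (x ∘ suc)))

length-prefix-++ : ∀ n x w → length (prefix n x ++ w) ≡ n + length w
length-prefix-++ zero    x w = refl
length-prefix-++ (suc n) x w = cong suc (length-prefix-++ n (x ∘ suc) w)

pad-prefix-++ : ∀ n x w {m} → m < n → pad (prefix n x ++ w) m ≡ x m
pad-prefix-++ (suc n) x w {zero}  _        = refl
pad-prefix-++ (suc n) x w {suc m} (s≤s lt) = pad-prefix-++ n (x ∘ suc) w lt

pad-prefix : ∀ n x {m} → m < n → pad (prefix n x) m ≡ x m
pad-prefix n x lt = subst (λ w → pad w _ ≡ x _) (++-identityʳ (prefix n x)) (pad-prefix-++ n x [] lt)

AgreeOn : ℕ → ℕ → Subset → Subset → Set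
AgreeOn a b f x = ∀ m → a ≤ m → m < b → x m ≡ f m

agreeOn-trans : ∀ {a b c f g h} → b ≤ c → AgreeOn a b f g → AgreeOn a c g h → AgreeOn a b f h
agreeOn-trans b≤c fg gh m a≤m m<b = trans (gh m a≤m (<-≤-trans m<b b≤c)) (fg m a≤m m<b)

agree⇒extends : ∀ w x → AgreeOn 0 (length w) (pad w) x → Extends w x
agree⇒extends []      x _  = tt
agree⇒extends (b ∷ w) x ag = ag 0 z≤n (s≤s z≤n) , agree⇒extends w (x ∘ suc) (λ m _ lt → ag (suc m) z≤n (s≤s lt))

paste : ℕ → Subset → Subset → Subset
paste a f g m = if does (m <? a) then f m else g m

paste-below : ∀ {a m} f g → m < a → paste a f g m ≡ f m
paste-below {a} {m} f g m<a rewrite dec-true (m <? a) m<a = refl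

paste-above : ∀ {a m} f g → a ≤ m → paste a f g m ≡ g m
paste-above {a} {m} f g a≤m rewrite dec-false (m <? a) (≤⇒≯ a≤m) = refl

-- Avoidable sets

-- Every configuration on [a, ℓ) extends to one on [a, ℓ') that keeps a point out of N,
-- whatever the point does below a; for a = 0 this is nowhere density.
AvoidableAbove : ℕ → (Subset → Set) → Set
AvoidableAbove a N = ∀ ℓ g → a ≤ ℓ →
  ∃[ ℓ' ] Σ Subset λ g' → ℓ ≤ ℓ' × AgreeOn a ℓ g g' × (∀ x → AgreeOn a ℓ' g' x → ¬ N x)

Avoidable : (Subset → Set) → Set
Avoidable = AvoidableAbove 0

nowhereDense⇒avoidable : ∀ {N} → NowhereDense N → Avoidable N
nowhereDense⇒avoidable nd ℓ g _ with nd (prefix ℓ g)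
... | t , avoids = length w , pad w , ℓ≤ , (λ m _ lt → pad-prefix-++ ℓ g t lt) , λ x ag → avoids x (agree⇒extends w x ag)
  where
  w = prefix ℓ g ++ t
  ℓ≤ : ℓ ≤ length w
  ℓ≤ = subst (ℓ ≤_) (sym (length-prefix-++ ℓ g t)) (m≤m+n ℓ (length t))

avoidable-⊆ : ∀ {a A B} → (∀ x → B x → A x) → AvoidableAbove a A → AvoidableAbove a B
avoidable-⊆ B⊆A av ℓ g a≤ℓ with av ℓ g a≤ℓ
... | ℓ' , g' , ℓ≤ℓ' , ag , avoids = ℓ' , g' , ℓ≤ℓ' , ag , λ x agx → avoids x agx ∘ B⊆A x

avoidable-∅ : ∀ {a} → AvoidableAbove a (λ _ → ⊥)
avoidable-∅ ℓ g _ = ℓ , g , ≤-refl , (λ _ _ _ → refl) , λ _ _ ()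

avoidable-⊎ : ∀ {a A B} → AvoidableAbove a A → AvoidableAbove a B → AvoidableAbove a (λ x → A x ⊎ B x)
avoidable-⊎ avA avB ℓ g a≤ℓ with avA ℓ g a≤ℓ
... | ℓ₁ , g₁ , ℓ≤ℓ₁ , ag₁ , avoids₁ with avB ℓ₁ g₁ (≤-trans a≤ℓ ℓ≤ℓ₁)
... | ℓ₂ , g₂ , ℓ₁≤ℓ₂ , ag₂ , avoids₂ =
  ℓ₂ , g₂ , ≤-trans ℓ≤ℓ₁ ℓ₁≤ℓ₂ , agreeOn-trans ℓ≤ℓ₁ ag₁ ag₂ , avoids
  where
  avoids : ∀ x → AgreeOn _ ℓ₂ g₂ x → ¬ (_ ⊎ _)
  avoids x agx (inj₁ Ax) = avoids₁ x (agreeOn-trans ℓ₁≤ℓ₂ ag₂ agx) Ax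
  avoids x agx (inj₂ Bx) = avoids₂ x agx Bx

avoidable-restrict : ∀ {N} a f → Avoidable N → AvoidableAbove a (λ x → AgreeOn 0 a f x × N x)
avoidable-restrict a f av ℓ g a≤ℓ with av ℓ (paste a f g) z≤n
... | ℓ' , g' , ℓ≤ℓ' , ag , avoids =
  ℓ' , g' , ℓ≤ℓ' , (λ m a≤m m<ℓ → trans (ag m z≤n m<ℓ) (paste-above f g a≤m)) ,
  λ x agx (xf , Nx) → avoids x (agrees x xf agx) Nx
  where
  agrees : ∀ x → AgreeOn 0 a f x → AgreeOn a ℓ' g' x → AgreeOn 0 ℓ' g' x
  agrees x xf xg' m _ m<ℓ' with <-≤-connex m a
  ... | inj₁ m<a = trans (xf m z≤n m<a) (sym (trans (ag m z≤n (<-≤-trans m<a a≤ℓ)) (paste-below f g m<a)))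
  ... | inj₂ a≤m = xg' m a≤m m<ℓ'

-- Finitely many words of length a cover all behaviours below a.
avoidable-raise : ∀ {N} a → Avoidable N → AvoidableAbove a N
avoidable-raise {N} a av =
  avoidable-⊆ (λ x Nx → prefix a x , prefix∈words a x , (λ m _ lt → sym (pad-prefix a x lt)) , Nx) (over (words a))
  where
  over : ∀ ws → AvoidableAbove a (λ x → ∃[ w ] (w ∈ ws × AgreeOn 0 a (pad w) x × N x))
  over []       = avoidable-⊆ (λ { x (_ , () , _) }) avoidable-∅
  over (w ∷ ws) = avoidable-⊆ split (avoidable-⊎ (avoidable-restrict a (pad w) av) (over ws))
    where
    split : ∀ x → ∃[ v ] (v ∈ w ∷ ws × AgreeOn 0 a (pad v) x × N x) →
            (AgreeOn 0 a (pad w) x × N x) ⊎ ∃[ v ] (v ∈ ws × AgreeOn 0 a (pad v) x × N x)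
    split x (v , here refl , rest)  = inj₁ rest
    split x (v , there v∈ws , rest) = inj₂ (v , v∈ws , rest)

avoidable-≤ : ∀ {a} {N : ℕ → Subset → Set} → (∀ i → AvoidableAbove a (N i)) →
              ∀ j → AvoidableAbove a (λ x → ∃[ i ] (i ≤ j × N i x))
avoidable-≤ av zero    = avoidable-⊆ (λ { x (.0 , z≤n , Nx) → Nx }) (av 0)
avoidable-≤ {N = N} av (suc j) = avoidable-⊆ split (avoidable-⊎ (av (suc j)) (avoidable-≤ av j))
  where
  split : ∀ x → ∃[ i ] (i ≤ suc j × N i x) → N (suc j) x ⊎ ∃[ i ] (i ≤ j × N i x)
  split x (i , i≤ , Nx) with m≤n⇒m<n∨m≡n i≤
  ... | inj₁ (s≤s i≤j) = inj₂ (i , i≤j , Nx)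
  ... | inj₂ refl      = inj₁ Nx

-- Block sequences

-- The doubling is what makes shifted copies of different blocks almost disjoint.
record Blocks (N : ℕ → Subset → Set) : Set where
  field
    start end       : ℕ → ℕ
    template        : ℕ → Subset
    start≤end       : ∀ j → start j ≤ end j
    doubling        : ∀ j → end j + end j ≤ start (suc j)
    template-avoids : ∀ j x → AgreeOn (start j) (end j) (template j) x → ∀ {i} → i ≤ j → ¬ N i x

blocks : ∀ {N} → (∀ i → Avoidable (N i)) → Blocks N
blocks {N} av = record
  { start = start ; end = end ; template = template
  ; start≤end = λ j → proj₁ (proj₂ (proj₂ (block j)))
  ; doubling = λ _ → ≤-refl
  ; template-avoids = λ j x ag i≤j Nx → proj₂ (proj₂ (proj₂ (block j))) x ag (_ , i≤j , Nx)
  }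
  where
  BlockFrom : ℕ → ℕ → Set
  BlockFrom a j = ∃[ b ] Σ Subset λ p → a ≤ b × (∀ x → AgreeOn a b p x → ¬ (∃[ i ] (i ≤ j × N i x)))

  block-from : ∀ a j → BlockFrom a j
  block-from a j with avoidable-≤ (λ i → avoidable-raise a (av i)) j a (λ _ → false) ≤-refl
  ... | b , p , a≤b , _ , avoids = b , p , a≤b , avoids

  start : ℕ → ℕ
  start zero    = 0
  start (suc j) = let b = proj₁ (block-from (start j) j) in b + b

  block : ∀ j → BlockFrom (start j) j
  block j = block-from (start j) j

  end : ℕ → ℕ
  end j = proj₁ (block j)

  template : ℕ → Subset
  template j = proj₁ (proj₂ (block j))

module BlockSequence {N} (B : Blocks N) where
  open Blocks B

  InBlock : ℕ → ℕ → Set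
  InBlock j n = start j ≤ n × n < end j

  start-mono : ∀ {i j} → i ≤ j → start i ≤ start j
  start-mono {j = zero} z≤n = ≤-refl
  start-mono {i} {suc j} i≤ with m≤n⇒m<n∨m≡n i≤
  ... | inj₁ (s≤s i≤j) = ≤-trans (start-mono i≤j) (≤-trans (start≤end j) (≤-trans (m≤m+n (end j) (end j)) (doubling j)))
  ... | inj₂ refl      = ≤-refl

  end+end≤start : ∀ {i j} → i < j → end i + end i ≤ start j
  end+end≤start {i} i<j = ≤-trans (doubling i) (start-mono i<j)

  end-mono : ∀ {i j} → i ≤ j → end i ≤ end j
  end-mono {i} {j} i≤j with m≤n⇒m<n∨m≡n i≤j
  ... | inj₁ i<j = ≤-trans (m≤m+n (end i) (end i)) (≤-trans (end+end≤start i<j) (start≤end j))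
  ... | inj₂ refl = ≤-refl

  inBlock-< : ∀ {i j n m} → i < j → InBlock i n → InBlock j m → n + n < m
  inBlock-< i<j (_ , n<end) (start≤m , _) = <-≤-trans (+-mono-< n<end n<end) (≤-trans (end+end≤start i<j) start≤m)

  inBlock-unique : ∀ {j j' n} → InBlock j n → InBlock j' n → j ≡ j'
  inBlock-unique {j} {j'} {n} n∈j n∈j' with <-cmp j j'
  ... | tri< j<j' _ _ = ⊥-elim (<⇒≱ (inBlock-< j<j' n∈j n∈j') (m≤m+n n n))
  ... | tri≈ _ j≡j' _ = j≡j'
  ... | tri> _ _ j'<j = ⊥-elim (<⇒≱ (inBlock-< j'<j n∈j' n∈j) (m≤m+n n n))

  inBlock-near : ∀ {j j' n m} k → InBlock j n → InBlock j' m → m ≤ n → n ≤ k + m → j ≡ j' ⊎ n < k + k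
  inBlock-near {j} {j'} {n} {m} k n∈j m∈j' m≤n n≤k+m with <-cmp j j'
  ... | tri< j<j' _ _ = ⊥-elim (<⇒≱ (inBlock-< j<j' n∈j m∈j') (≤-trans m≤n (m≤m+n n n)))
  ... | tri≈ _ j≡j' _ = inj₁ j≡j'
  ... | tri> _ _ j'<j = inj₂ (≤-<-trans n≤k+m (+-monoʳ-< k m<k))
    where
    m<k : m < k
    m<k = +-cancelʳ-< m m k (<-≤-trans (inBlock-< j'<j m∈j' n∈j) n≤k+m)

-- J is an arbitrary predicate, so membership in glue J is decided classically.
module Glue (em : ExcludedMiddle 0ℓ) {N} (B : Blocks N) where
  open Blocks B
  open BlockSequence B

  GlueAt : (ℕ → Set) → ℕ → Set
  GlueAt J n = ∃[ j ] (J j × InBlock j n × template j n ≡ true)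

  glue : (ℕ → Set) → Subset
  glue J n = does (em {GlueAt J n})

  glue-true : ∀ {J n} → glue J n ≡ true → ∃[ j ] (J j × InBlock j n)
  glue-true {J} {n} with em {GlueAt J n}
  ... | yes (j , Jj , n∈j , _) = λ _ → j , Jj , n∈j
  ... | no _                   = λ ()

  glue-on-block : ∀ {J j n} → J j → InBlock j n → glue J n ≡ template j n
  glue-on-block {J} {j} {n} Jj n∈j with em {GlueAt J n}
  ... | yes (j' , _ , n∈j' , t≡true) rewrite inBlock-unique n∈j n∈j' = sym t≡true
  ... | no ¬glued with template j n in t≡
  ...   | true  = ⊥-elim (¬glued (j , Jj , n∈j , t≡))
  ...   | false = refl

  glue-avoids : ∀ {J j i} → J j → i ≤ j → ¬ N i (glue J)
  glue-avoids {J} {j} Jj = template-avoids j (glue J) (λ m lo hi → glue-on-block Jj (lo , hi))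

  glue-cong : ∀ {J₁ J₂} → (∀ {j} → J₁ j → J₂ j) → (∀ {j} → J₂ j → J₁ j) → glue J₁ ≈ glue J₂
  glue-cong to from n = does-⇔ (mk⇔ (λ (j , Jj , rest) → j , to Jj , rest) (λ (j , Jj , rest) → j , from Jj , rest)) em em

  glue-near-ordered : ∀ {J₁ J₂ c} → (∀ {j} → J₁ j → J₂ j → j ≤ c) →
                      ∀ {k n m} → glue J₁ n ≡ true → glue J₂ m ≡ true → m ≤ n → n ≤ k + m → n < end c + (k + k)
  glue-near-ordered {c = c} shared {k} n∈ m∈ m≤n n≤k+m with glue-true n∈ | glue-true m∈
  ... | j , J₁j , n∈j | j' , J₂j' , m∈j' with inBlock-near k n∈j m∈j' m≤n n≤k+m
  ...   | inj₁ refl = <-≤-trans (proj₂ n∈j) (≤-trans (end-mono (shared J₁j J₂j')) (m≤m+n _ _))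
  ...   | inj₂ n<2k = <-≤-trans n<2k (m≤n+m (k + k) (end c))

  glue-near : ∀ {J₁ J₂ c} → (∀ {j} → J₁ j → J₂ j → j ≤ c) →
              ∀ {k n m} → glue J₁ n ≡ true → glue J₂ m ≡ true → n ≤ k + m → m ≤ k + n → n < end c + (k + k)
  glue-near shared {n = n} {m} n∈ m∈ n≤k+m m≤k+n with ≤-total m n
  ... | inj₁ m≤n = glue-near-ordered shared n∈ m∈ m≤n n≤k+m
  ... | inj₂ n≤m = ≤-<-trans n≤m (glue-near-ordered (λ a b → shared b a) m∈ n∈ n≤m m≤k+n)

≈⇒⊆ : ∀ {A B} → A ≈ B → A ⊆ B
≈⇒⊆ A≈B n = subst T (A≈B n)

shift-cong : ∀ {A B} → A ≈ B → ∀ k → shift A k ≈ shift B k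
shift-cong A≈B (+ k) n with k ≤? n
... | yes _ = A≈B (n ∸ k)
... | no _  = refl
shift-cong A≈B -[1+ k ] n = A≈B (n + suc k)

∩-shift-cong : ∀ {A A' B B'} → A ≈ A' → B ≈ B' → ∀ k → (A ∩ shift B k) ≈ (A' ∩ shift B' k)
∩-shift-cong A≈A' B≈B' k n = cong₂ _∧_ (A≈A' n) (shift-cong B≈B' k n)

shift-zero : ∀ A → shift A (+ 0) ≈ A
shift-zero A n with 0 ≤? n
... | yes _  = refl
... | no 0≰n = ⊥-elim (0≰n z≤n)

shift-true : ∀ B k {n} → shift B k n ≡ true → ∃[ m ] (B m ≡ true × n ≤ ∣ k ∣ + m × m ≤ ∣ k ∣ + n)
shift-true B (+ k) {n} Bm with k ≤? n
... | yes _ = n ∸ k , Bm , m≤n+m∸n n k , ≤-trans (m∸n≤m n k) (m≤n+m n k)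
shift-true B (+ k) {n} () | no _
shift-true B -[1+ k ] {n} Bm =
  n + suc k , Bm , ≤-trans (m≤m+n n (suc k)) (m≤n+m (n + suc k) (suc k)) , ≤-reflexive (+-comm n (suc k))

finite-∩-shift : ∀ {A B} (bound : ℕ → ℕ) →
                 (∀ {k n m} → A n ≡ true → B m ≡ true → n ≤ k + m → m ≤ k + n → n < bound k) →
                 ∀ k → Finite (A ∩ shift B k)
finite-∩-shift {A} {B} bound near k = bound ∣ k ∣ , outside
  where
  outside : ∀ n → bound ∣ k ∣ ≤ n → A n ∧ shift B k n ≡ false
  outside n bound≤n with A n in An | shift B k n in Sn
  ... | false | _     = refl
  ... | true  | false = refl
  ... | true  | true  with shift-true B k Sn
  ...   | m , Bm , n≤ , m≤ = ⊥-elim (<⇒≱ (near An Bm n≤ m≤) bound≤n)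

pushBit : Bool → ℕ → ℕ
pushBit b     (suc c) = suc (suc (pushBit b c))
pushBit false zero    = 0
pushBit true  zero    = 1

pushBit-injective : ∀ {b b' c c'} → pushBit b c ≡ pushBit b' c' → b ≡ b' × c ≡ c'
pushBit-injective {false} {false} {zero}  {zero}  _  = refl , refl
pushBit-injective {true}  {true}  {zero}  {zero}  _  = refl , refl
pushBit-injective {false} {true}  {zero}  {zero}  ()
pushBit-injective {true}  {false} {zero}  {zero}  ()
pushBit-injective {false} {_}     {zero}  {suc _} ()
pushBit-injective {true}  {_}     {zero}  {suc _} ()
pushBit-injective {_}     {false} {suc _} {zero}  ()
pushBit-injective {_}     {true}  {suc _} {zero}  ()
pushBit-injective {c = suc c} {suc c'} e with pushBit-injective {c = c} {c'} (suc-injective (suc-injective e))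
... | refl , refl = refl , refl

n≤pushBit : ∀ b c → c ≤ pushBit b c
n≤pushBit b     (suc c) = s≤s (≤-trans (n≤pushBit b c) (n≤1+n _))
n≤pushBit b     zero    = z≤n

code : Subset → ℕ → ℕ
code x zero    = 0
code x (suc m) = suc (pushBit (x m) (code x m))

code-≥ : ∀ x m → m ≤ code x m
code-≥ x zero    = z≤n
code-≥ x (suc m) = s≤s (≤-trans (code-≥ x m) (n≤pushBit (x m) (code x m)))

code-mono : ∀ x {m m'} → m ≤ m' → code x m ≤ code x m'
code-mono x {m' = zero} z≤n = ≤-refl
code-mono x {m} {suc m'} m≤ with m≤n⇒m<n∨m≡n m≤
... | inj₁ (s≤s m≤m') = ≤-trans (code-mono x m≤m') (≤-trans (n≤pushBit (x m') (code x m')) (n≤1+n _))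
... | inj₂ refl       = ≤-refl

code-cong : ∀ {x y} → x ≈ y → ∀ m → code x m ≡ code y m
code-cong x≈y zero    = refl
code-cong x≈y (suc m) = cong suc (cong₂ pushBit (x≈y m) (code-cong x≈y m))

code-injective : ∀ x y {m m'} → code x m ≡ code y m' → m ≡ m' × (∀ d → d < m → x d ≡ y d)
code-injective x y {zero}  {zero}   _ = refl , λ _ ()
code-injective x y {suc m} {suc m'} e with pushBit-injective (suc-injective e)
... | x≡y , codes≡ with code-injective x y codes≡
... | refl , agree = refl , λ d d<1+m → agree-below d (m≤n⇒m<n∨m≡n (≤-pred d<1+m))
  where
  agree-below : ∀ d → d < m ⊎ d ≡ m → x d ≡ y d
  agree-below d (inj₁ d<m) = agree d d<m
  agree-below d (inj₂ refl) = x≡y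

shared-code≤ : ∀ {x y d m m'} → x d ≢ y d → code x m ≡ code y m' → code x m ≤ code x d
shared-code≤ {x} {y} {d} x≢y e with code-injective x y e
... | _ , agree = code-mono x (≮⇒≥ (λ d<m → x≢y (agree d d<m)))

≉⇒differ : ExcludedMiddle 0ℓ → ∀ {x y : Subset} → ¬ x ≈ y → ∃[ d ] (x d ≢ y d)
≉⇒differ em {x} {y} x≉y with em {∃[ d ] (x d ≢ y d)}
... | yes differ = differ
... | no ¬differ = ⊥-elim (x≉y λ d → decidable-stable (x d ≟ᵇ y d) (λ x≢y → ¬differ (d , x≢y)))

module Family (em : ExcludedMiddle 0ℓ) {N} (B : Blocks N) where
  open Blocks B
  open Glue em B

  OnBranch : Subset → ℕ → Set
  OnBranch x j = ∃[ m ] (code x m ≡ j)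

  branchSet : Subset → Subset
  branchSet x = glue (OnBranch x)

  branchSet-avoids : ∀ x i → ¬ N i (branchSet x)
  branchSet-avoids x i = glue-avoids (i , refl) (code-≥ x i)

  branchSet-cong : ∀ {x y} → x ≈ y → branchSet x ≈ branchSet y
  branchSet-cong x≈y = glue-cong (λ (m , e) → m , trans (sym (code-cong x≈y m)) e)
                                 (λ (m , e) → m , trans (code-cong x≈y m) e)

  branchSet-almost-disjoint : ∀ {x y d} → x d ≢ y d → ∀ k → Finite (branchSet x ∩ shift (branchSet y) k)
  branchSet-almost-disjoint {x} {y} {d} x≢y =
    finite-∩-shift (λ k → end (code x d) + (k + k)) (glue-near shared)
    where
    shared : ∀ {j} → OnBranch x j → OnBranch y j → j ≤ code x d
    shared (m , refl) (m' , e) = shared-code≤ x≢y (sym e)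

meager-ideal-TAD : ExcludedMiddle 0ℓ → ∀ {I} → IsIdeal I → Meager I →
                   Σ (Subset → Set) λ 𝒜 → IsTAD I 𝒜 × HasCardContinuum 𝒜
meager-ideal-TAD em {I} ideal (N , nd , cover) =
  𝒜 , (𝒜⊆I⁺ , 𝒜-almost-disjoint) , branchSet , (λ x → x , λ _ → refl) , branchSet-injective , λ _ A∈𝒜 → A∈𝒜
  where
  open IsIdeal ideal
  open Family em (blocks (λ i → nowhereDense⇒avoidable (nd i)))

  𝒜 : Subset → Set
  𝒜 A = ∃[ x ] (branchSet x ≈ A)

  branchSet∉I : ∀ x → ¬ I (branchSet x)
  branchSet∉I x x∈I = let (i , Ni) = cover _ x∈I in branchSet-avoids x i Ni

  branchSet-∩-shift∈I : ∀ {x y} → ¬ x ≈ y → ∀ k → I (branchSet x ∩ shift (branchSet y) k)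
  branchSet-∩-shift∈I x≉y k = let (d , x≢y) = ≉⇒differ em x≉y in finite-mem _ (branchSet-almost-disjoint x≢y k)

  𝒜⊆I⁺ : ∀ A → 𝒜 A → Positive I A
  𝒜⊆I⁺ A (x , x≈A) A∈I = branchSet∉I x (subset-closed _ _ (≈⇒⊆ x≈A) A∈I)

  𝒜-almost-disjoint : ∀ A B → 𝒜 A → 𝒜 B → ¬ A ≈ B → ∀ k → I (A ∩ shift B k)
  𝒜-almost-disjoint A B (x , x≈A) (y , y≈B) A≉B k =
    subset-closed _ _ (≈⇒⊆ (∩-shift-cong (sym ∘ x≈A) (sym ∘ y≈B) k))
      (branchSet-∩-shift∈I (λ x≈y → A≉B λ n → trans (sym (x≈A n)) (trans (branchSet-cong x≈y n) (y≈B n))) k)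

  branchSet-injective : ∀ x y → branchSet x ≈ branchSet y → x ≈ y
  branchSet-injective x y sets≈ with em {x ≈ y}
  ... | yes x≈y = x≈y
  ... | no x≉y  = ⊥-elim (branchSet∉I x (subset-closed _ _ (≈⇒⊆ self≈∩shift) (branchSet-∩-shift∈I x≉y (+ 0))))
    where
    self≈∩shift : branchSet x ≈ (branchSet x ∩ shift (branchSet y) (+ 0))
    self≈∩shift n = trans (sym (∧-idem (branchSet x n))) (cong (branchSet x n ∧_) (trans (sets≈ n) (sym (shift-zero (branchSet y) n))))

-- Ideals with the Baire property

avoiding-point : ExcludedMiddle 0ℓ → ∀ {N : ℕ → Subset → Set} → (∀ i → Avoidable (N i)) → ∃[ z ] (∀ i → ¬ N i z)
avoiding-point em av = glue (λ _ → ⊤) , λ i → glue-avoids {j = i} tt ≤-refl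
  where open Glue em (blocks av)

splice : List Bool → (Bool → Bool) → Subset → Subset
splice s h x = paste (length s) (pad s) (h ∘ x)

splice-extends : ∀ s h x → Extends s (splice s h x)
splice-extends s h x = agree⇒extends s _ (λ m _ m<n → paste-below (pad s) (h ∘ x) m<n)

avoidable-∘-splice : ∀ {N} s h → (∀ b → h (h b) ≡ b) → Avoidable N → Avoidable (N ∘ splice s h)
avoidable-∘-splice s h h-inv av ℓ f _ with av (ℓ + length s) (splice s h f) z≤n
... | ℓ' , g' , ℓ+n≤ℓ' , g'≈ , avoids =
  ℓ' , g , ≤-trans (m≤m+n ℓ n) ℓ+n≤ℓ' , g-agrees , λ x agx → avoids (splice s h x) (splice-agrees x agx)
  where
  n = length s
  g = paste n f (h ∘ g')

  g-agrees : AgreeOn 0 ℓ f g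
  g-agrees m _ m<ℓ with <-≤-connex m n
  ... | inj₁ m<n = paste-below f (h ∘ g') m<n
  ... | inj₂ n≤m = begin
    g m             ≡⟨ paste-above f (h ∘ g') n≤m ⟩
    h (g' m)        ≡⟨ cong h (g'≈ m z≤n (<-≤-trans m<ℓ (m≤m+n ℓ n))) ⟩
    h (splice s h f m) ≡⟨ cong h (paste-above (pad s) (h ∘ f) n≤m) ⟩
    h (h (f m))     ≡⟨ h-inv (f m) ⟩
    f m             ∎
    where open ≡-Reasoning

  splice-agrees : ∀ x → AgreeOn 0 ℓ' g x → AgreeOn 0 ℓ' g' (splice s h x)
  splice-agrees x agx m _ m<ℓ' with <-≤-connex m n
  ... | inj₁ m<n = trans (paste-below (pad s) (h ∘ x) m<n)
                         (sym (trans (g'≈ m z≤n (<-≤-trans m<n (m≤n+m n ℓ))) (paste-below (pad s) (h ∘ f) m<n)))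
  ... | inj₂ n≤m = begin
    splice s h x m  ≡⟨ paste-above (pad s) (h ∘ x) n≤m ⟩
    h (x m)         ≡⟨ cong h (agx m z≤n m<ℓ') ⟩
    h (g m)         ≡⟨ cong h (paste-above f (h ∘ g') n≤m) ⟩
    h (h (g' m))    ≡⟨ h-inv (g' m) ⟩
    g' m            ∎
    where open ≡-Reasoning

initial : ℕ → Subset
initial n m = does (m <? n)

initial-finite : ∀ n → Finite (initial n)
initial-finite n = n , λ m n≤m → dec-false (m <? n) (≤⇒≯ n≤m)

splices-cover : ∀ s z → whole ⊆ ((initial (length s) ∪ splice s id z) ∪ splice s not z)
splices-cover s z m _ with <-≤-connex m (length s)
... | inj₁ m<n rewrite dec-true (m <? length s) m<n = tt
... | inj₂ n≤m rewrite dec-false (m <? length s) (≤⇒≯ n≤m) with z m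
...   | true  = tt
...   | false = tt

avoidable-splices : ∀ {N} s → Avoidable N → Avoidable (λ z → N (splice s id z) ⊎ N (splice s not z))
avoidable-splices s av = avoidable-⊎ (avoidable-∘-splice s id (λ _ → refl) av) (avoidable-∘-splice s not not-involutive av)

-- If I were comeager on [ s ], a generic z would put both splices of z and of its complement
-- onto s into I, and together with the first |s| points they cover ℕ.
ideal-not-comeager-in-cylinder : ExcludedMiddle 0ℓ → ∀ {I} {N : ℕ → Subset → Set} s → IsIdeal I →
                                 (∀ i → NowhereDense (N i)) → ¬ (∀ x → Extends s x → ¬ I x → ∃[ i ] N i x)
ideal-not-comeager-in-cylinder em {I} {N} s ideal nd comeager =
  no-generic-point (avoiding-point em (λ i → avoidable-splices s (nowhereDense⇒avoidable (nd i))))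
  where
  open IsIdeal ideal

  no-generic-point : ¬ (∃[ z ] (∀ i → ¬ (N i (splice s id z) ⊎ N i (splice s not z))))
  no-generic-point (z , z-generic) =
    whole-not-mem (subset-closed whole (A ∪ C) (splices-cover s z)
      (union-closed A C (union-closed (initial (length s)) (splice s id z)
                           (finite-mem (initial (length s)) (initial-finite (length s))) (splice∈I id inj₁))
                        (splice∈I not inj₂)))
    where
    A = initial (length s) ∪ splice s id z
    C = splice s not z

    splice∈I : ∀ h → (∀ {i} → N i (splice s h z) → N i (splice s id z) ⊎ N i (splice s not z)) → I (splice s h z)
    splice∈I h into with em {I (splice s h z)}
    ... | yes ∈I = ∈I
    ... | no ∉I with comeager (splice s h z) (splice-extends s h z) ∉I
    ...   | i , Ni = ⊥-elim (z-generic i (into Ni))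

baire-ideal-meager : ExcludedMiddle 0ℓ → ∀ {I} → IsIdeal I → HasBaireProperty I → Meager I
baire-ideal-meager em ideal (W , N , nd , cover) with em {∃[ s ] W s}
... | yes (s , Ws) = ⊥-elim (ideal-not-comeager-in-cylinder em s ideal nd
                       (λ x x∈s x∉I → cover x (inj₂ ((s , Ws , x∈s) , x∉I))))
... | no W-empty   = N , nd , λ x x∈I → cover x (inj₁ (x∈I , λ (s , Ws , _) → W-empty (s , Ws)))

theorem3p2 : ExcludedMiddle 0ℓ →
    (I : Subset → Set) → IsIdeal I → HasBaireProperty I →
    Σ (Subset → Set) λ 𝒜 → IsTAD I 𝒜 × HasCardContinuum 𝒜
theorem3p2 em I ideal baire = meager-ideal-TAD em ideal (baire-ideal-meager em ideal baire)
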